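{- Assume $t_m<l_m$. For every vertex $v$ of tenacity $t_m$: (1) the set $B(v)$ is a singleton; (2) every $\mathrm{maxlevel}(v)$ path contains exactly one bridge of tenacity $t_m$.
   Context: $G=(V,E)$ is a finite undirected graph and $M$ a matching; edges in $M$ are matched, others unmatched; a vertex is unmatched if no matched edge is incident to it. An alternating path is a simple path alternating between matched and unmatched edges; an augmenting path is one joining two distinct unmatched vertices; $l_m$ is the minimum length of an augmenting path ($\infty$ if none). $\mathrm{evenlevel}(v)$ ($\mathrm{oddlevel}(v)$) is the length of a minimum even (odd) length alternating path from some unmatched vertex to $v$ ($\infty$ if none); such a path is an $\mathrm{evenlevel}(v)$ ($\mathrm{oddlevel}(v)$) path. $\mathrm{minlevel}(v)$, $\mathrm{maxlevel}(v)$ are the smaller and larger of these; a $\mathrm{maxlevel}(v)$ ($\mathrm{minlevel}(v)$) path is an evenlevel$(v)$ or oddlevel$(v)$ path of length $\mathrm{maxlevel}(v)$ ($\mathrm{minlevel}(v)$). A vertex with finite minlevel is outer if $\mathrm{evenlevel}(v)<\mathrm{oddlevel}(v)$ and inner otherwise. Tenacity: $\mathrm{t}(v)=\mathrm{evenlevel}(v)+\mathrm{oddlevel}(v)$; an unmatched edge $(u,v)$ has $\mathrm{t}(u,v)=\mathrm{evenlevel}(u)+\mathrm{evenlevel}(v)+1$, a matched one $\mathrm{t}(u,v)=\mathrm{oddlevel}(u)+\mathrm{oddlevel}(v)+1$. $t_m$ is the minimum tenacity of a vertex. If $(u,v)$ is the last edge of some $\mathrm{minlevel}(v)$ path, $(u,v)$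 is called a prop; an edge that is not a prop is a bridge. An odd $t$ with $t_m\le t<l_m$ is an eligible tenacity. For $v$ of eligible tenacity $t$ and $p$ an evenlevel$(v)$ or oddlevel$(v)$ path starting at unmatched $f$, $F(p,v)$ is the vertex of tenacity $>t$ on $p$ that is farthest from $f$ along $p$ ($f$ itself has tenacity $>t$). $B(v)=\{F(p,v): p \text{ an evenlevel}(v) \text{ or oddlevel}(v) \text{ path}\}$. -}

module Defs where

open import Data.Nat using (ℕ; zero; suc; _+_; _≤_; _<_; _%_; _⊔_; _⊓_)
open import Data.Fin using (Fin)
open import Data.Product using (Σ; ∃; _×_; _,_)
open import Data.Sum using (_⊎_)
open import Relation.Nullary using (¬_)
open import Relation.Binary.PropositionalEquality using (_≡_)

data ℕ∞ : Set where
  fin : ℕ → ℕ∞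
  ∞   : ℕ∞

infixl 6 _+∞_
_+∞_ : ℕ∞ → ℕ∞ → ℕ∞
fin a +∞ fin b = fin (a + b)
fin _ +∞ ∞     = ∞
∞     +∞ _     = ∞

data _≤∞_ : ℕ∞ → ℕ∞ → Set where
  fin≤fin : ∀ {a b} → a ≤ b → fin a ≤∞ fin b
  _≤∞∞    : ∀ x → x ≤∞ ∞

_<∞_ : ℕ∞ → ℕ∞ → Set
x <∞ y = (x ≤∞ y) × ¬ (x ≡ y)

min∞ : ℕ∞ → ℕ∞ → ℕ∞
min∞ (fin a) (fin b) = fin (a ⊓ b)
min∞ (fin a) ∞       = fin a
min∞ ∞       y       = y

max∞ : ℕ∞ → ℕ∞ → ℕ∞
max∞ (fin a) (fin b) = fin (a ⊔ b)
max∞ (fin a) ∞       = ∞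
max∞ ∞       y       = ∞

record Graph (n : ℕ) : Set₁ where
  field
    Adj    : Fin n → Fin n → Set
    sym    : ∀ {u v} → Adj u v → Adj v u
    irrefl : ∀ {u} → ¬ Adj u u

record Matching {n : ℕ} (G : Graph n) : Set₁ where
  field
    M      : Fin n → Fin n → Set
    sub    : ∀ {u v} → M u v → Graph.Adj G u v
    sym    : ∀ {u v} → M u v → M v u
    unique : ∀ {u v w} → M u v → M u w → v ≡ w

module _ {n : ℕ} {G : Graph n} (Mt : Matching G) where
  open Graph G
  open Matching Mt

  Unmatched : Fin n → Set
  Unmatched v = ∀ w → ¬ M v w

  -- A path of length len is given by its vertices vtx 0, …, vtx len
  -- (values of vtx beyond len are irrelevant).  Edge i is (vtx i, vtx (i+1)).
  record AltPath : Set where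
    field
      len    : ℕ
      vtx    : ℕ → Fin n
      simple : ∀ i j → i ≤ len → j ≤ len → vtx i ≡ vtx j → i ≡ j
      adj    : ∀ i → i < len → Adj (vtx i) (vtx (suc i))
      alt    : ∀ i → suc i < len →
                 (M (vtx i) (vtx (suc i)) → ¬ M (vtx (suc i)) (vtx (suc (suc i))))
               × (¬ M (vtx i) (vtx (suc i)) → M (vtx (suc i)) (vtx (suc (suc i))))
  open AltPath public

  PathTo : Fin n → AltPath → Set
  PathTo v p = Unmatched (vtx p 0) × vtx p (len p) ≡ v

  IsEven IsOdd : ℕ → Set
  IsEven k = k % 2 ≡ 0
  IsOdd  k = k % 2 ≡ 1

  Augmenting : AltPath → Set
  Augmenting p = Unmatched (vtx p 0) × Unmatched (vtx p (len p))
               × ¬ (vtx p 0 ≡ vtx p (len p))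

  IsMinAugLength : ℕ∞ → Set
  IsMinAugLength l = (∀ p → Augmenting p → l ≤∞ fin (len p))
                   × (l ≡ ∞ ⊎ Σ AltPath λ p → Augmenting p × fin (len p) ≡ l)

  ParityLevel : (ℕ → Set) → Fin n → ℕ∞ → Set
  ParityLevel Par v (fin k) = Par k × (Σ AltPath λ p → PathTo v p × len p ≡ k)
                            × (∀ p → PathTo v p → Par (len p) → k ≤ len p)
  ParityLevel Par v ∞       = ∀ p → PathTo v p → ¬ Par (len p)

  IsEvenLevel IsOddLevel : Fin n → ℕ∞ → Set
  IsEvenLevel = ParityLevel IsEven
  IsOddLevel  = ParityLevel IsOdd

  module Levels (el ol : Fin n → ℕ∞) where

    tenacity : Fin n → ℕ∞
    tenacity v = el v +∞ ol v

    minlevel maxlevel : Fin n → ℕ∞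
    minlevel v = min∞ (el v) (ol v)
    maxlevel v = max∞ (el v) (ol v)

    IsMinTenacity : ℕ∞ → Set
    IsMinTenacity t = (∃ λ v → tenacity v ≡ t) × (∀ v → t ≤∞ tenacity v)

    LevelPath : Fin n → AltPath → Set
    LevelPath v p = PathTo v p
                  × ((IsEven (len p) × fin (len p) ≡ el v)
                     ⊎ (IsOdd (len p) × fin (len p) ≡ ol v))

    MinlevelPath MaxlevelPath : Fin n → AltPath → Set
    MinlevelPath v p = LevelPath v p × fin (len p) ≡ minlevel v
    MaxlevelPath v p = LevelPath v p × fin (len p) ≡ maxlevel v

    -- (u,v) is a prop: it is the last edge of some minlevel(v) path
    -- (or, the edge being undirected, of some minlevel(u) path)
    PropEdge' : Fin n → Fin n → Set
    PropEdge' u v = Σ AltPath λ p → MinlevelPath v p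
                  × Σ ℕ λ k → suc k ≡ len p × vtx p k ≡ u

    PropEdge : Fin n → Fin n → Set
    PropEdge u v = PropEdge' u v ⊎ PropEdge' v u

    Bridge : Fin n → Fin n → Set
    Bridge u v = Adj u v × ¬ PropEdge u v

    EdgeTenacity : Fin n → Fin n → ℕ∞ → Set
    EdgeTenacity u v t = (M u v → ol u +∞ ol v +∞ fin 1 ≡ t)
                       × (¬ M u v → el u +∞ el v +∞ fin 1 ≡ t)

    -- F(p,v) = w for tenacity t of v: w is the vertex of tenacity > t on p
    -- farthest from the start of p
    IsF : ℕ∞ → AltPath → Fin n → Set
    IsF t p w = Σ ℕ λ i → i ≤ len p × vtx p i ≡ w × t <∞ tenacity w
              × (∀ j → i < j → j ≤ len p → ¬ (t <∞ tenacity (vtx p j)))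

    InB : ℕ∞ → Fin n → Fin n → Set
    InB t v w = Σ AltPath λ p → LevelPath v p × IsF t p w

-- Let v have tenacity T = t_m; its levels L > m satisfy L + m = T, so T is odd.  A maxlevel path P
-- and a minlevel path Q of v must meet, or P followed by Q reversed would be an augmenting path of length
-- T < l_m.  Take k to be the last meeting position; it is the same on both paths.  For i > k the
-- alternating path Q followed by P reversed down to P_i (and symmetrically) has length T - i and the
-- opposite parity, so P_i has levels exactly i and T - i: all vertices past the junction have tenacity T.
-- Hence with T = 2h + 1 the edge P_h P_{h+1} has both end levels h: it has tenacity T and is no prop,
-- while any other edge of tenacity T on P has unequal end levels and is a prop.  For B(v): the F-vertex
-- of a level path lies at or before the junction P_k = Q_k; if that junction has tenacity > T it is the
-- F-vertex of both paths, otherwise the two prefixes are level paths of P_k, whose minlevel is at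
-- most k < m, and induction on the minlevel applies.

module Submission where

open import Defs
open import Data.Nat using (ℕ; zero; suc; _+_; _∸_; _≤_; _<_; _%_; _⊓_; _⊔_; z≤n; s≤s; _≤?_; _<?_; parity)
open import Data.Nat.Properties
open import Data.Nat.Induction using (<-rec)
open import Data.Parity.Base as ℙ using (Parity; 0ℙ; 1ℙ; _⁻¹)
open import Data.Parity.Properties as ℙₚ using (p≢p⁻¹; +-homo-+)
open import Data.Fin using (Fin) renaming (_≟_ to _≟ᶠ_)
open import Data.Product using (Σ; ∃; _×_; _,_; proj₁; proj₂)
open import Data.Sum using (_⊎_; inj₁; inj₂; [_,_]′)
open import Data.Empty using (⊥; ⊥-elim)
open import Function.Bundles using (_⇔_; mk⇔; Equivalence)
open import Relation.Nullary using (¬_; Dec; yes; no)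
open import Relation.Unary using (Decidable)
open import Relation.Binary.PropositionalEquality
open import Relation.Binary.Definitions using (Tri; tri<; tri≈; tri>)

fin-injective : ∀ {a b} → fin a ≡ fin b → a ≡ b
fin-injective refl = refl

fin-≤∞ : ∀ {a b} → fin a ≤∞ fin b → a ≤ b
fin-≤∞ (fin≤fin a≤b) = a≤b

+-tight : ∀ {a i c j} → a ≤ i → c ≤ j → i + j ≤ a + c → a ≡ i × c ≡ j
+-tight {a} {i} {c} {j} a≤i c≤j i+j≤a+c =
  ≤-antisym a≤i (+-cancelʳ-≤ j i a (≤-trans i+j≤a+c (+-monoʳ-≤ a c≤j))) ,
  ≤-antisym c≤j (+-cancelˡ-≤ i j c (≤-trans i+j≤a+c (+-monoˡ-≤ c a≤i)))

fin<∞fin : ∀ {a b} → a < b → fin a <∞ fin b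
fin<∞fin a<b = fin≤fin (<⇒≤ a<b) , λ e → <⇒≢ a<b (fin-injective e)

fin<∞∞ : ∀ a → fin a <∞ ∞
fin<∞∞ a = (fin a ≤∞∞) , λ ()

fin<∞? : ∀ a z → Dec (fin a <∞ z)
fin<∞? a (fin b) with a <? b
... | yes a<b = yes (fin<∞fin a<b)
... | no  a≮b = no λ { (fin≤fin a≤b , a≢b) → a≮b (≤∧≢⇒< a≤b (λ e → a≢b (cong fin e))) }
fin<∞? a ∞ = yes (fin<∞∞ a)

≤∞∧≮∞⇒≡ : ∀ {a z} → fin a ≤∞ z → ¬ (fin a <∞ z) → z ≡ fin a
≤∞∧≮∞⇒≡ {a} (fin≤fin {b = b} a≤b) a≮b with a ≟ b
... | yes refl = refl
... | no  a≢b  = ⊥-elim (a≮b (fin≤fin a≤b , λ e → a≢b (fin-injective e)))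
≤∞∧≮∞⇒≡ {a} (_ ≤∞∞) a≮∞ = ⊥-elim (a≮∞ (fin<∞∞ a))

+∞-fin⁻¹ : ∀ p q {t} → p +∞ q +∞ fin 1 ≡ fin t
         → ∃ λ a → ∃ λ b → p ≡ fin a × q ≡ fin b × suc (a + b) ≡ t
+∞-fin⁻¹ (fin a) (fin b) e = a , b , refl , refl , trans (+-comm 1 (a + b)) (fin-injective e)
+∞-fin⁻¹ (fin a) ∞ ()
+∞-fin⁻¹ ∞ q ()

double-injective : ∀ {a b} → a + a ≡ b + b → a ≡ b
double-injective {a} {b} e with <-cmp a b
... | tri< a<b _ _ = ⊥-elim (<⇒≢ (+-mono-< a<b a<b) e)
... | tri≈ _ a≡b _ = a≡b
... | tri> _ _ b<a = ⊥-elim (<⇒≢ (+-mono-< b<a b<a) (sym e))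

parity-suc : ∀ k → parity (suc k) ≡ parity k ⁻¹
parity-suc k = +-homo-+ 1 k

≡∨≡⁻¹ : ∀ p q → p ≡ q ⊎ p ≡ q ⁻¹
≡∨≡⁻¹ 0ℙ 0ℙ = inj₁ refl
≡∨≡⁻¹ 0ℙ 1ℙ = inj₂ refl
≡∨≡⁻¹ 1ℙ 0ℙ = inj₂ refl
≡∨≡⁻¹ 1ℙ 1ℙ = inj₁ refl

p+q≡1ℙ⇒q≡p⁻¹ : ∀ p q → p ℙ.+ q ≡ 1ℙ → q ≡ p ⁻¹
p+q≡1ℙ⇒q≡p⁻¹ 0ℙ q e = e
p+q≡1ℙ⇒q≡p⁻¹ 1ℙ 0ℙ e = refl
p+q≡1ℙ⇒q≡p⁻¹ 1ℙ 1ℙ ()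

parity-+-odd : ∀ a b → parity (a + b) ≡ 1ℙ → parity b ≡ parity a ⁻¹
parity-+-odd a b odd = p+q≡1ℙ⇒q≡p⁻¹ (parity a) (parity b) (trans (sym (+-homo-+ a b)) odd)

parity-+-congʳ : ∀ {a b} → parity a ≡ parity b → ∀ c → parity (a + c) ≡ parity (b + c)
parity-+-congʳ {a} {b} pa≡pb c =
  trans (+-homo-+ a c) (trans (cong (ℙ._+ parity c) pa≡pb) (sym (+-homo-+ b c)))

+-∸-rotate : ∀ {i n} a → i ≤ n → i + (a + (n ∸ i)) ≡ n + a
+-∸-rotate {i} {n} a i≤n = begin
  i + (a + (n ∸ i))  ≡⟨ sym (+-assoc i a (n ∸ i)) ⟩
  i + a + (n ∸ i)    ≡⟨ cong (_+ (n ∸ i)) (+-comm i a) ⟩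
  a + i + (n ∸ i)    ≡⟨ +-assoc a i (n ∸ i) ⟩
  a + (i + (n ∸ i))  ≡⟨ cong (a +_) (m+[n∸m]≡n i≤n) ⟩
  a + n              ≡⟨ +-comm a n ⟩
  n + a              ∎
  where open ≡-Reasoning

parity-suc-cong : ∀ {a b} → parity a ≡ parity b → parity (suc a) ≡ parity (suc b)
parity-suc-cong {a} {b} pa≡pb = trans (parity-suc a) (trans (cong _⁻¹ pa≡pb) (sym (parity-suc b)))

odd⇒1+2h : ∀ t → parity t ≡ 1ℙ → ∃ λ h → suc (h + h) ≡ t
odd⇒1+2h 0 ()
odd⇒1+2h 1 _ = 0 , refl
odd⇒1+2h (suc (suc t)) odd with odd⇒1+2h t odd
... | h , refl = suc h , cong (λ x → suc (suc x)) (+-suc h h)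

%2-parity : ∀ k → (k % 2 ≡ 0 × parity k ≡ 0ℙ) ⊎ (k % 2 ≡ 1 × parity k ≡ 1ℙ)
%2-parity 0 = inj₁ (refl , refl)
%2-parity 1 = inj₂ (refl , refl)
%2-parity (suc (suc k)) = %2-parity k

HasParity : Parity → ℕ → Set
HasParity 0ℙ k = k % 2 ≡ 0
HasParity 1ℙ k = k % 2 ≡ 1

hasParity⇔ : ∀ π k → HasParity π k ⇔ parity k ≡ π
hasParity⇔ π k with %2-parity k
hasParity⇔ 0ℙ k | inj₁ (k%2≡0 , even) = mk⇔ (λ _ → even) (λ _ → k%2≡0)
hasParity⇔ 1ℙ k | inj₂ (k%2≡1 , odd)  = mk⇔ (λ _ → odd) (λ _ → k%2≡1)
hasParity⇔ 1ℙ k | inj₁ (k%2≡0 , even) =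
  mk⇔ (λ k%2≡1 → ⊥-elim (0≢1+n (trans (sym k%2≡0) k%2≡1)))
      (λ odd → ⊥-elim (p≢p⁻¹ 0ℙ (trans (sym even) odd)))
hasParity⇔ 0ℙ k | inj₂ (k%2≡1 , odd)  =
  mk⇔ (λ k%2≡0 → ⊥-elim (0≢1+n (trans (sym k%2≡0) k%2≡1)))
      (λ even → ⊥-elim (p≢p⁻¹ 1ℙ (trans (sym odd) even)))

+-⁻¹ : ∀ p q → p ℙ.+ q ⁻¹ ≡ (p ℙ.+ q) ⁻¹
+-⁻¹ 0ℙ q  = refl
+-⁻¹ 1ℙ 0ℙ = refl
+-⁻¹ 1ℙ 1ℙ = refl

offset-parity-+ : ∀ π i k → π ℙ.+ parity (i + k) ≡ (π ℙ.+ parity k) ℙ.+ parity i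
offset-parity-+ π i k = begin
  π ℙ.+ parity (i + k)           ≡⟨ cong (π ℙ.+_) (trans (+-homo-+ i k) (ℙₚ.+-comm (parity i) (parity k))) ⟩
  π ℙ.+ (parity k ℙ.+ parity i)  ≡⟨ sym (ℙₚ.+-assoc π (parity k) (parity i)) ⟩
  (π ℙ.+ parity k) ℙ.+ parity i  ∎
  where open ≡-Reasoning

-- Rearranges  parity s = parity (s ∸ suc i) + parity (suc i)  into the parity of a reversed edge.
offset-parity-reversed : ∀ π p q → π ℙ.+ p ≡ (π ℙ.+ (p ℙ.+ q ⁻¹)) ⁻¹ ℙ.+ q
offset-parity-reversed 0ℙ 0ℙ 0ℙ = refl
offset-parity-reversed 0ℙ 0ℙ 1ℙ = refl
offset-parity-reversed 0ℙ 1ℙ 0ℙ = refl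
offset-parity-reversed 0ℙ 1ℙ 1ℙ = refl
offset-parity-reversed 1ℙ 0ℙ 0ℙ = refl
offset-parity-reversed 1ℙ 0ℙ 1ℙ = refl
offset-parity-reversed 1ℙ 1ℙ 0ℙ = refl
offset-parity-reversed 1ℙ 1ℙ 1ℙ = refl

largest : {P : ℕ → Set} → Decidable P → ∀ N →
  (∀ r → r < N → ¬ P r) ⊎ (∃ λ r → r < N × P r × (∀ r′ → r < r′ → r′ < N → ¬ P r′))
largest P? zero = inj₁ (λ _ ())
largest P? (suc N) with P? N
... | yes PN = inj₂ (N , ≤-refl , PN , λ r′ N<r′ r′<1+N → ⊥-elim (<⇒≱ N<r′ (≤-pred r′<1+N)))
... | no ¬PN with largest P? N
...   | inj₁ none = inj₁ λ r r<1+N → [ none r , (λ { refl → ¬PN }) ]′ (m≤n⇒m<n∨m≡n (≤-pred r<1+N))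
...   | inj₂ (r , r<N , Pr , above) = inj₂ (r , m<n⇒m<1+n r<N , Pr ,
          λ r′ r<r′ r′<1+N → [ above r′ r<r′ , (λ { refl → ¬PN }) ]′ (m≤n⇒m<n∨m≡n (≤-pred r′<1+N)))

-- Splicing sequences

splice : {A : Set} → ℕ → (ℕ → A) → (ℕ → A) → ℕ → A
splice a       f g zero    = f zero
splice zero    f g (suc j) = g j
splice (suc a) f g (suc i) = splice a (λ k → f (suc k)) g i

splice-≤ : {A : Set} (a : ℕ) (f g : ℕ → A) {i : ℕ} → i ≤ a → splice a f g i ≡ f i
splice-≤ a       f g {zero}  _         = refl
splice-≤ (suc a) f g {suc i} (s≤s i≤a) = splice-≤ a (λ k → f (suc k)) g i≤a

splice-> : {A : Set} (a : ℕ) (f g : ℕ → A) (j : ℕ) → splice a f g (suc a + j) ≡ g j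
splice-> zero    f g j = refl
splice-> (suc a) f g j = splice-> a (λ k → f (suc k)) g j

≤⊎≡suc+ : ∀ a i → i ≤ a ⊎ ∃ λ j → i ≡ suc a + j
≤⊎≡suc+ a i with i ≤? a
... | yes i≤a = inj₁ i≤a
... | no  i≰a = inj₂ (i ∸ suc a , sym (m+[n∸m]≡n (≰⇒> i≰a)))

splice-at-suc : {A : Set} (a : ℕ) (f g : ℕ → A) → splice a f g (suc a) ≡ g 0
splice-at-suc a f g = trans (cong (splice a f g) (sym (+-identityʳ (suc a)))) (splice-> a f g 0)

splice-steps : {A : Set} (R : ℕ → A → A → Set) (a ℓ : ℕ) (f g : ℕ → A)
  → (∀ i → i < a → R i (f i) (f (suc i)))
  → R a (f a) (g 0)
  → (∀ j → j < ℓ → R (suc a + j) (g j) (g (suc j)))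
  → ∀ i → i < suc a + ℓ → R i (splice a f g i) (splice a f g (suc i))
splice-steps R a ℓ f g in-f joint in-g i i< with ≤⊎≡suc+ a i
... | inj₂ (j , refl) =
  subst₂ (R (suc a + j)) (sym (splice-> a f g j))
    (trans (sym (splice-> a f g (suc j))) (cong (splice a f g) (cong suc (+-suc a j))))
    (in-g j (+-cancelˡ-< (suc a) j ℓ i<))
... | inj₁ i≤a with m≤n⇒m<n∨m≡n i≤a
...   | inj₁ i<a = subst₂ (R i) (sym (splice-≤ a f g i≤a)) (sym (splice-≤ a f g i<a)) (in-f i i<a)
...   | inj₂ refl = subst₂ (R a) (sym (splice-≤ a f g ≤-refl)) (sym (splice-at-suc a f g)) joint

splice-injective : {A : Set} (a ℓ : ℕ) (f g : ℕ → A)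
  → (∀ i j → i ≤ a → j ≤ a → f i ≡ f j → i ≡ j)
  → (∀ i j → i ≤ ℓ → j ≤ ℓ → g i ≡ g j → i ≡ j)
  → (∀ i j → i ≤ a → j ≤ ℓ → f i ≢ g j)
  → ∀ i j → i ≤ suc a + ℓ → j ≤ suc a + ℓ → splice a f g i ≡ splice a f g j → i ≡ j
splice-injective a ℓ f g inj-f inj-g disjoint i j i≤ j≤ e with ≤⊎≡suc+ a i | ≤⊎≡suc+ a j
... | inj₁ i≤a | inj₁ j≤a =
  inj-f i j i≤a j≤a (trans (sym (splice-≤ a f g i≤a)) (trans e (splice-≤ a f g j≤a)))
... | inj₁ i≤a | inj₂ (j′ , refl) = ⊥-elim (disjoint i j′ i≤a (+-cancelˡ-≤ (suc a) j′ ℓ j≤)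
  (trans (sym (splice-≤ a f g i≤a)) (trans e (splice-> a f g j′))))
... | inj₂ (i′ , refl) | inj₁ j≤a = ⊥-elim (disjoint j i′ j≤a (+-cancelˡ-≤ (suc a) i′ ℓ i≤)
  (trans (sym (splice-≤ a f g j≤a)) (trans (sym e) (splice-> a f g i′))))
... | inj₂ (i′ , refl) | inj₂ (j′ , refl) = cong (suc a +_)
  (inj-g i′ j′ (+-cancelˡ-≤ (suc a) i′ ℓ i≤) (+-cancelˡ-≤ (suc a) j′ ℓ j≤)
    (trans (sym (splice-> a f g i′)) (trans e (splice-> a f g j′))))

-- Alternating segments

module Segments {n : ℕ} {G : Graph n} (Mt : Matching G) where
  open Graph G using (Adj) renaming (sym to Adj-sym)
  open Matching Mt using (M) renaming (sym to M-sym)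

  -- An edge at position i of an alternating path from an unmatched vertex is matched iff i is odd.
  MatchedIffOdd : Fin n → Fin n → Parity → Set
  MatchedIffOdd x y π = M x y ⇔ π ≡ 1ℙ

  matchedIffOdd-sym : ∀ {x y π} → MatchedIffOdd x y π → MatchedIffOdd y x π
  matchedIffOdd-sym e = mk⇔ (λ m → to (M-sym m)) (λ o → M-sym (from o))
    where open Equivalence e

  matchedIffOdd-unique : ∀ {x y π ρ} → MatchedIffOdd x y π → MatchedIffOdd x y ρ → π ≡ ρ
  matchedIffOdd-unique {π = 1ℙ} e e′ = sym (Equivalence.to e′ (Equivalence.from e refl))
  matchedIffOdd-unique {π = 0ℙ} {0ℙ} e e′ = refl
  matchedIffOdd-unique {π = 0ℙ} {1ℙ} e e′ = Equivalence.to e (Equivalence.from e′ refl)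

  Alternate : Fin n → Fin n → Fin n → Set
  Alternate x y z = (M x y → ¬ M y z) × (¬ M x y → M y z)

  matchedIffOdd-alternate : ∀ {x y z σ} → MatchedIffOdd x y σ → MatchedIffOdd y z (σ ⁻¹) → Alternate x y z
  matchedIffOdd-alternate {σ = 0ℙ} e e′ =
    (λ m → ⊥-elim (p≢p⁻¹ 0ℙ (Equivalence.to e m))) , (λ _ → Equivalence.from e′ refl)
  matchedIffOdd-alternate {σ = 1ℙ} e e′ =
    (λ _ m → p≢p⁻¹ 0ℙ (Equivalence.to e′ m)) , (λ ¬m → ⊥-elim (¬m (Equivalence.from e refl)))

  matchedIffOdd-next : ∀ {x y z σ} → MatchedIffOdd x y σ → Alternate x y z → MatchedIffOdd y z (σ ⁻¹)
  matchedIffOdd-next {σ = 0ℙ} e (_ , unm⇒m) =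
    mk⇔ (λ _ → refl) (λ _ → unm⇒m (λ m → p≢p⁻¹ 0ℙ (Equivalence.to e m)))
  matchedIffOdd-next {σ = 1ℙ} e (m⇒unm , _) = mk⇔ (λ m → ⊥-elim (m⇒unm (Equivalence.from e refl) m)) (λ ())

  -- π is the parity of the position of the first edge.
  record Segment (π : Parity) : Set where
    field
      size        : ℕ
      at          : ℕ → Fin n
      injective   : ∀ i j → i ≤ size → j ≤ size → at i ≡ at j → i ≡ j
      adjacent    : ∀ i → i < size → Adj (at i) (at (suc i))
      alternating : ∀ i → i < size → MatchedIffOdd (at i) (at (suc i)) (π ℙ.+ parity i)
  open Segment public

  toAltPath : ∀ {π} → Segment π → AltPath Mt
  toAltPath {π} S = record
    { len = size S ; vtx = at S ; simple = injective S ; adj = adjacent S ; alt = alt′ }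
    where
    alt′ : ∀ i → suc i < size S → Alternate (at S i) (at S (suc i)) (at S (suc (suc i)))
    alt′ i i+1<s = matchedIffOdd-alternate (alternating S i (<-trans (n<1+n i) i+1<s))
      (subst (MatchedIffOdd (at S (suc i)) (at S (suc (suc i))))
             (trans (cong (π ℙ.+_) (parity-suc i)) (+-⁻¹ π (parity i)))
             (alternating S (suc i) i+1<s))

  edge-matchedIffOdd : (p : AltPath Mt) → Unmatched Mt (vtx p 0) →
                       ∀ i → i < len p → MatchedIffOdd (vtx p i) (vtx p (suc i)) (parity i)
  edge-matchedIffOdd p u zero    _ = mk⇔ (λ m → ⊥-elim (u _ m)) (λ ())
  edge-matchedIffOdd p u (suc i) i+1<l =
    subst (MatchedIffOdd (vtx p (suc i)) (vtx p (suc (suc i)))) (sym (parity-suc i))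
      (matchedIffOdd-next (edge-matchedIffOdd p u i (<-trans (n<1+n i) i+1<l)) (alt p i i+1<l))

  fromAltPath : (p : AltPath Mt) → Unmatched Mt (vtx p 0) → Segment 0ℙ
  fromAltPath p u = record
    { size = len p ; at = vtx p ; injective = simple p ; adjacent = adj p
    ; alternating = edge-matchedIffOdd p u }

  take : ∀ {π} (S : Segment π) k → k ≤ size S → Segment π
  take S k k≤s = record
    { size = k ; at = at S
    ; injective = λ i j i≤k j≤k → injective S i j (≤-trans i≤k k≤s) (≤-trans j≤k k≤s)
    ; adjacent = λ i i<k → adjacent S i (<-≤-trans i<k k≤s)
    ; alternating = λ i i<k → alternating S i (<-≤-trans i<k k≤s) }

  drop : ∀ {π} (S : Segment π) k → k ≤ size S → Segment (π ℙ.+ parity k)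
  drop {π} S k k≤s = record
    { size = size S ∸ k ; at = λ i → at S (i + k)
    ; injective = λ i j i≤ j≤ e → +-cancelʳ-≡ k i j (injective S _ _ (shift i≤) (shift j≤) e)
    ; adjacent = λ i i< → adjacent S (i + k) (shift i<)
    ; alternating = λ i i< → subst (MatchedIffOdd (at S (i + k)) (at S (suc i + k)))
                                   (offset-parity-+ π i k) (alternating S (i + k) (shift i<)) }
    where
    shift : ∀ {i} → i ≤ size S ∸ k → i + k ≤ size S
    shift = m≤o∸n⇒m+n≤o _ k≤s

  reverse : ∀ {π} (S : Segment π) → Segment ((π ℙ.+ parity (size S)) ⁻¹)
  reverse {π} S = record
    { size = s ; at = λ i → at S (s ∸ i)
    ; injective = λ i j i≤s j≤s e → ∸-cancelˡ-≡ i≤s j≤s (injective S _ _ (m∸n≤m s i) (m∸n≤m s j) e)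
    ; adjacent = λ i i<s → subst (λ k → Adj (at S k) (at S (s ∸ suc i))) (suc[s∸suc] i<s)
                             (Adj-sym (adjacent S (s ∸ suc i) (mirror i<s)))
    ; alternating = λ i i<s → subst₂ (λ k → MatchedIffOdd (at S k) (at S (s ∸ suc i)))
                                  (suc[s∸suc] i<s) (parity-mirror i i<s)
                                  (matchedIffOdd-sym (alternating S (s ∸ suc i) (mirror i<s))) }
    where
    s = size S
    suc[s∸suc] : ∀ {i} → i < s → suc (s ∸ suc i) ≡ s ∸ i
    suc[s∸suc] i<s = sym (+-∸-assoc 1 i<s)
    mirror : ∀ {i} → i < s → s ∸ suc i < s
    mirror {i} i<s = ≤-trans (≤-reflexive (suc[s∸suc] i<s)) (m∸n≤m s i)
    parity-mirror : ∀ i → i < s → π ℙ.+ parity (s ∸ suc i) ≡ (π ℙ.+ parity s) ⁻¹ ℙ.+ parity i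
    parity-mirror i i<s = begin
      π ℙ.+ parity (s ∸ suc i)
        ≡⟨ offset-parity-reversed π (parity (s ∸ suc i)) (parity i) ⟩
      (π ℙ.+ (parity (s ∸ suc i) ℙ.+ parity i ⁻¹)) ⁻¹ ℙ.+ parity i
        ≡⟨ cong (λ q → (π ℙ.+ q) ⁻¹ ℙ.+ parity i)
                (trans (cong (parity (s ∸ suc i) ℙ.+_) (sym (parity-suc i)))
                       (trans (sym (+-homo-+ (s ∸ suc i) (suc i))) (cong parity (m∸n+n≡m i<s)))) ⟩
      (π ℙ.+ parity s) ⁻¹ ℙ.+ parity i
        ∎
      where open ≡-Reasoning

  Disjoint : ∀ {π ρ} → Segment π → Segment ρ → Set
  Disjoint A B = ∀ i j → i ≤ size A → j ≤ size B → at A i ≢ at B j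

  append : ∀ {π} (A : Segment π) (B : Segment (π ℙ.+ parity (suc (size A))))
         → Adj (at A (size A)) (at B 0)
         → MatchedIffOdd (at A (size A)) (at B 0) (π ℙ.+ parity (size A))
         → Disjoint A B → Segment π
  append {π} A B joint-adj joint-alt disjoint = record
    { size = suc a + size B
    ; at = splice a (at A) (at B)
    ; injective = splice-injective a (size B) (at A) (at B) (injective A) (injective B) disjoint
    ; adjacent = splice-steps (λ _ → Adj) a (size B) (at A) (at B) (adjacent A) joint-adj (adjacent B)
    ; alternating = splice-steps (λ i x y → MatchedIffOdd x y (π ℙ.+ parity i)) a (size B) (at A) (at B)
        (alternating A) joint-alt
        (λ j j< → subst (MatchedIffOdd (at B j) (at B (suc j))) (shift j) (alternating B j j<)) }
    where
    a = size A
    shift : ∀ j → (π ℙ.+ parity (suc a)) ℙ.+ parity j ≡ π ℙ.+ parity (suc a + j)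
    shift j = sym (trans (cong (λ k → π ℙ.+ parity k) (+-comm (suc a) j)) (offset-parity-+ π j (suc a)))

  reindex : ∀ {ρ σ} → ρ ≡ σ → Segment ρ → Segment σ
  reindex ρ≡σ S = record
    { size = size S ; at = at S ; injective = injective S ; adjacent = adjacent S
    ; alternating = λ i i< → subst (λ τ → MatchedIffOdd (at S i) (at S (suc i)) (τ ℙ.+ parity i)) ρ≡σ
                                   (alternating S i i<) }

  point : ∀ {π} → Fin n → Segment π
  point y = record
    { size = 0 ; at = λ _ → y ; injective = λ { _ _ z≤n z≤n _ → refl }
    ; adjacent = λ _ () ; alternating = λ _ () }

  extend : (A : Segment 0ℙ) (y : Fin n)
         → Adj (at A (size A)) y → MatchedIffOdd (at A (size A)) y (parity (size A))
         → (∀ i → i ≤ size A → at A i ≢ y) → Segment 0ℙ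
  extend A y joint-adj joint-alt fresh =
    append A (point y) joint-adj joint-alt (λ i _ i≤ _ → fresh i i≤)

  -- A₀ … A_a  followed by  B_{s+1} … B_end, where A_a = B_s.
  joinForward : (A : Segment 0ℙ) (a : ℕ) → a ≤ size A
              → (B : Segment 0ℙ) (s : ℕ) → s < size B
              → at A a ≡ at B s → parity a ≡ parity s
              → (∀ i j → i ≤ a → s < j → j ≤ size B → at A i ≢ at B j)
              → Segment 0ℙ
  joinForward A a a≤ B s s< A≡B pa≡ps disjoint =
    append (take A a a≤) (reindex (trans (parity-suc s) (trans (cong _⁻¹ (sym pa≡ps)) (sym (parity-suc a))))
                                  (drop B (suc s) s<))
      (subst (λ x → Adj x (at B (suc s))) (sym A≡B) (adjacent B s s<))
      (subst₂ (λ x π → MatchedIffOdd x (at B (suc s)) π) (sym A≡B) (sym pa≡ps) (alternating B s s<))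
      (λ i j i≤a j≤ → disjoint i (j + suc s) i≤a (m≤n+m (suc s) j) (m≤o∸n⇒m+n≤o j s< j≤))

  -- A₀ … A_a  followed by  B_b, B_{b-1}, …, B_c.
  joinReverse : (A : Segment 0ℙ) (a : ℕ) → a ≤ size A
              → (B : Segment 0ℙ) (b c : ℕ) → b ≤ size B → c ≤ b
              → parity a ≡ parity b
              → Adj (at A a) (at B b) → MatchedIffOdd (at A a) (at B b) (parity a)
              → (∀ i j → i ≤ a → c ≤ j → j ≤ b → at A i ≢ at B j)
              → Segment 0ℙ
  joinReverse A a a≤ B b c b≤ c≤b pa≡pb joint-adj joint-alt disjoint =
    append (take A a a≤)
      (reindex (trans (cong _⁻¹ (sym pa≡pb)) (sym (parity-suc a)))
               (take (reverse (take B b b≤)) (b ∸ c) (m∸n≤m b c)))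
      joint-adj joint-alt
      (λ i j i≤a j≤ → disjoint i (b ∸ j) i≤a
                        (m+n≤o⇒m≤o∸n c (subst (_≤ b) (+-comm j c) (m≤o∸n⇒m+n≤o j c≤b j≤))) (m∸n≤m b j))

  prefix : (p : AltPath Mt) → ∀ k → k ≤ len p → AltPath Mt
  prefix p k k≤l = record
    { len = k ; vtx = vtx p
    ; simple = λ i j i≤k j≤k → simple p i j (≤-trans i≤k k≤l) (≤-trans j≤k k≤l)
    ; adj = λ i i<k → adj p i (<-≤-trans i<k k≤l)
    ; alt = λ i i<k → alt p i (<-≤-trans i<k k≤l) }

-- Levels and tenacity

module Tenacity {n : ℕ} {G : Graph n} (Mt : Matching G) (el ol : Fin n → ℕ∞)
  (evenlevel : ∀ v → IsEvenLevel Mt v (el v)) (oddlevel : ∀ v → IsOddLevel Mt v (ol v))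
  (T : ℕ) (T≤tenacity : ∀ v → fin T ≤∞ Levels.tenacity Mt el ol v)
  (T<augmenting : ∀ p → Augmenting Mt p → T < len p) where

  open Graph G using (Adj) renaming (sym to Adj-sym)
  open Segments Mt
  open Levels Mt el ol

  Path : Set
  Path = AltPath Mt

  level : Parity → Fin n → ℕ∞
  level 0ℙ = el
  level 1ℙ = ol

  level-spec : ∀ π v → ParityLevel Mt (HasParity π) v (level π v)
  level-spec 0ℙ = evenlevel
  level-spec 1ℙ = oddlevel

  level-≤ : ∀ {x} (p : Path) → PathTo Mt x p → ∃ λ a → level (parity (len p)) x ≡ fin a × a ≤ len p
  level-≤ {x} p to-x with level (parity (len p)) x | level-spec (parity (len p)) x
  ... | fin a | _ , _ , minimal = a , refl , minimal p to-x (Equivalence.from (hasParity⇔ _ _) refl)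
  ... | ∞     | none          = ⊥-elim (none p to-x (Equivalence.from (hasParity⇔ _ _) refl))

  level≡⇒≤ : ∀ {x a} (p : Path) → PathTo Mt x p → level (parity (len p)) x ≡ fin a → a ≤ len p
  level≡⇒≤ p to-x level≡a with level-≤ p to-x
  ... | a′ , level≡a′ , a′≤ = subst (_≤ len p) (fin-injective (trans (sym level≡a′) level≡a)) a′≤

  level-path : ∀ π x {a} → level π x ≡ fin a → Σ Path λ p → PathTo Mt x p × len p ≡ a × parity a ≡ π
  level-path π x {a} level≡a with level π x | level-spec π x
  level-path π x refl | fin a | has-π , (p , to-x , len≡a) , _ =
    p , to-x , len≡a , Equivalence.to (hasParity⇔ π a) has-π

  Shortest : Fin n → Path → Set
  Shortest x p = PathTo Mt x p × level (parity (len p)) x ≡ fin (len p)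

  level-shortest : ∀ π x {a} → level π x ≡ fin a → Σ Path λ p → Shortest x p × len p ≡ a × parity a ≡ π
  level-shortest π x level≡a with level-path π x level≡a
  ... | p , to-x , refl , refl = p , (to-x , level≡a) , refl , refl

  levelPath⇒shortest : ∀ {v} p → LevelPath v p → Shortest v p
  levelPath⇒shortest p (to-v , inj₁ (even , el≡)) =
    to-v , subst (λ π → level π _ ≡ fin (len p)) (sym (Equivalence.to (hasParity⇔ 0ℙ (len p)) even)) (sym el≡)
  levelPath⇒shortest p (to-v , inj₂ (odd , ol≡)) =
    to-v , subst (λ π → level π _ ≡ fin (len p)) (sym (Equivalence.to (hasParity⇔ 1ℙ (len p)) odd)) (sym ol≡)

  shortest⇒levelPath : ∀ {v} p → Shortest v p → LevelPath v p
  shortest⇒levelPath p (to-v , level≡)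
    with parity (len p) | Equivalence.from (hasParity⇔ (parity (len p)) (len p)) refl
  ... | 0ℙ | even = to-v , inj₁ (even , sym level≡)
  ... | 1ℙ | odd  = to-v , inj₂ (odd , sym level≡)

  level-parity : ∀ π x {a} → level π x ≡ fin a → parity a ≡ π
  level-parity π x level≡a = proj₂ (proj₂ (proj₂ (level-path π x level≡a)))

  tenacity≡ : ∀ π x {a c} → level π x ≡ fin a → level (π ⁻¹) x ≡ fin c → tenacity x ≡ fin (a + c)
  tenacity≡ 0ℙ x e₁ e₂ rewrite e₁ | e₂ = refl
  tenacity≡ 1ℙ x {a} {c} e₁ e₂ rewrite e₁ | e₂ = cong fin (+-comm c a)

  T≤level+level : ∀ π x {a c} → level π x ≡ fin a → level (π ⁻¹) x ≡ fin c → T ≤ a + c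
  T≤level+level π x e₁ e₂ = fin-≤∞ (subst (fin T ≤∞_) (tenacity≡ π x e₁ e₂) (T≤tenacity x))

  minlevel≡ : ∀ π y {c b} → level π y ≡ fin c → level (π ⁻¹) y ≡ fin b → c ≤ b → minlevel y ≡ fin c
  minlevel≡ 0ℙ y e₁ e₂ c≤b rewrite e₁ | e₂ = cong fin (m≤n⇒m⊓n≡m c≤b)
  minlevel≡ 1ℙ y e₁ e₂ c≤b rewrite e₁ | e₂ = cong fin (m≥n⇒m⊓n≡n c≤b)

  minlevel≤level : ∀ π y {μ b} → minlevel y ≡ fin μ → level π y ≡ fin b → μ ≤ b
  minlevel≤level 0ℙ y {b = b} min≡ e rewrite e with ol y
  ... | fin o = subst (_≤ b) (fin-injective min≡) (m⊓n≤m b o)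
  ... | ∞     = ≤-reflexive (sym (fin-injective min≡))
  minlevel≤level 1ℙ y {b = b} min≡ e rewrite e with el y
  ... | fin o = subst (_≤ b) (fin-injective min≡) (m⊓n≤n o b)
  ... | ∞     = ≤-reflexive (sym (fin-injective min≡))

  ∃minlevel≤level : ∀ π w {a} → level π w ≡ fin a → ∃ λ μ → minlevel w ≡ fin μ × μ ≤ a
  ∃minlevel≤level 0ℙ w {a} e with el w | ol w
  ∃minlevel≤level 0ℙ w refl | fin a | fin o = a ⊓ o , refl , m⊓n≤m a o
  ∃minlevel≤level 0ℙ w refl | fin a | ∞ = a , refl , ≤-refl
  ∃minlevel≤level 1ℙ w {a} e with el w | ol w
  ∃minlevel≤level 1ℙ w refl | fin o | fin a = o ⊓ a , refl , m⊓n≤n o a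
  ∃minlevel≤level 1ℙ w refl | ∞ | fin a = a , refl , ≤-refl

  maxlevel≡ : ∀ π y {c b} → level π y ≡ fin c → level (π ⁻¹) y ≡ fin b → b ≤ c → maxlevel y ≡ fin c
  maxlevel≡ 0ℙ y e₁ e₂ b≤c rewrite e₁ | e₂ = cong fin (m≥n⇒m⊔n≡m b≤c)
  maxlevel≡ 1ℙ y e₁ e₂ b≤c rewrite e₁ | e₂ = cong fin (m≤n⇒m⊔n≡n b≤c)

  T≤opposite-paths : ∀ {x} (p q : Path) → PathTo Mt x p → PathTo Mt x q
                   → parity (len q) ≡ parity (len p) ⁻¹ → T ≤ len p + len q
  T≤opposite-paths p q to-p to-q opposite with level-≤ p to-p | level-≤ q to-q
  ... | a , level≡a , a≤ | c , level≡c , c≤ =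
    ≤-trans (T≤level+level (parity (len p)) _ level≡a (subst (λ π → level π _ ≡ fin c) opposite level≡c))
            (+-mono-≤ a≤ c≤)

  opposite-paths-of-length-T-are-shortest : ∀ {x} (p q : Path) → PathTo Mt x p → PathTo Mt x q
    → parity (len q) ≡ parity (len p) ⁻¹ → len p + len q ≡ T → Shortest x p × Shortest x q
  opposite-paths-of-length-T-are-shortest p q to-p to-q opposite p+q≡T
    with level-≤ p to-p | level-≤ q to-q
  ... | a , level≡a , a≤ | c , level≡c , c≤ with +-tight a≤ c≤ (subst (_≤ a + c) (sym p+q≡T)
         (T≤level+level (parity (len p)) _ level≡a (subst (λ π → level π _ ≡ fin c) opposite level≡c)))
  ... | refl , refl = (to-p , level≡a) , (to-q , level≡c)

  extend-or-revisit : ∀ {x y π a} → Adj x y → MatchedIffOdd x y π → level π x ≡ fin a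
    → (Σ Path λ R → PathTo Mt y R × len R ≡ suc a × vtx R a ≡ x)
    ⊎ (∃ λ r → r ≤ a × ∃ λ c → level (parity r) y ≡ fin c × c ≤ r)
  extend-or-revisit {x} {y} {π} x~y edge level≡a with level-path π x level≡a
  ... | A , (u , end) , refl , refl with anyUpTo? (λ r → vtx A r ≟ᶠ y) (suc (len A))
  ...   | yes (r , r<1+a , A[r]≡y) =
          inj₂ (r , ≤-pred r<1+a , level-≤ (prefix A r (≤-pred r<1+a)) (u , A[r]≡y))
  ...   | no y∉A = inj₁ (toAltPath R , (u , splice-> (len A) (vtx A) (λ _ → y) 0) ,
                         +-identityʳ (suc (len A)) , trans (splice-≤ (len A) (vtx A) _ ≤-refl) end)
    where
    R = extend (fromAltPath A u) y (subst (λ z → Adj z y) (sym end) x~y)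
          (subst (λ z → MatchedIffOdd z y (parity (len A))) (sym end) edge)
          (λ i i≤a A[i]≡y → y∉A (i , s≤s i≤a , A[i]≡y))

  -- A shortest path to x extended by the edge xy is a minlevel path of y.
  lower-end-edge⇒prop : ∀ {x y π a b} → Adj x y → MatchedIffOdd x y π
    → level π x ≡ fin a → level π y ≡ fin b → suc (a + b) ≡ T → a < b → PropEdge' x y
  lower-end-edge⇒prop {x} {y} {π} {a} {b} x~y edge level-x level-y 1+a+b≡T a<b
    with extend-or-revisit x~y edge level-x
  ... | inj₂ (r , r≤a , c , level-r , c≤r) = ⊥-elim (revisit (≡∨≡⁻¹ (parity r) π))
    where
    level-y-c : ∀ {σ} → parity r ≡ σ → level σ y ≡ fin c
    level-y-c r≡σ = subst (λ σ → level σ y ≡ fin c) r≡σ level-r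
    revisit : parity r ≡ π ⊎ parity r ≡ π ⁻¹ → ⊥
    revisit (inj₁ same) = <⇒≱ a<b
      (subst (_≤ a) (fin-injective (trans (sym (level-y-c same)) level-y)) (≤-trans c≤r r≤a))
    revisit (inj₂ opposite) = <⇒≱ (≤-reflexive 1+a+b≡T) (begin
      T      ≤⟨ T≤level+level π y level-y (level-y-c opposite) ⟩
      b + c  ≤⟨ +-monoʳ-≤ b (≤-trans c≤r r≤a) ⟩
      b + a  ≡⟨ +-comm b a ⟩
      a + b  ∎)
      where open ≤-Reasoning
  ... | inj₁ (R , to-y , len≡ , R[a]≡x) with level-≤ R to-y
  ...   | c , level-c , c≤ =
    R , (shortest⇒levelPath R (to-y , level-R) , sym minlevel-y) , a , sym len≡ , R[a]≡x
    where
    R-opposite : parity (len R) ≡ π ⁻¹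
    R-opposite = trans (cong parity len≡) (trans (parity-suc a) (cong _⁻¹ (level-parity π x level-x)))
    a<c : suc a ≤ c
    a<c = +-cancelʳ-≤ b (suc a) c (subst₂ _≤_ (sym 1+a+b≡T) (+-comm b c)
            (T≤level+level π y level-y (subst (λ σ → level σ y ≡ fin c) R-opposite level-c)))
    level-R : level (parity (len R)) y ≡ fin (len R)
    level-R = trans level-c (cong fin (≤-antisym c≤ (subst (_≤ c) (sym len≡) a<c)))
    minlevel-y : minlevel y ≡ fin (len R)
    minlevel-y = minlevel≡ (parity (len R)) y level-R
      (subst (λ σ → level σ y ≡ fin b) (sym (trans (cong _⁻¹ R-opposite) (ℙₚ.⁻¹-involutive π))) level-y)
      (subst (_≤ b) (sym len≡) a<b)

  equal-levels⇒¬prop : ∀ {x y π a} → MatchedIffOdd x y π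
    → level π x ≡ fin a → level π y ≡ fin a → ¬ PropEdge' x y
  equal-levels⇒¬prop {x} {y} {π} {a} edge level-x level-y (R , ((to-y , _) , minlevel-R) , k , 1+k≡ , R[k]≡x) =
    <⇒≱ (subst (_≤ a) (sym 1+k≡) (minlevel≤level π y (sym minlevel-R) level-y)) a≤k
    where
    k<len : k < len R
    k<len = ≤-reflexive 1+k≡
    last-edge : MatchedIffOdd x y (parity k)
    last-edge = subst₂ (λ u w → MatchedIffOdd u w (parity k)) R[k]≡x (trans (cong (vtx R) 1+k≡) (proj₂ to-y))
                  (edge-matchedIffOdd R (proj₁ to-y) k k<len)
    a≤k : a ≤ k
    a≤k = level≡⇒≤ (prefix R k (<⇒≤ k<len)) (proj₁ to-y , R[k]≡x)
            (subst (λ σ → level σ x ≡ fin a) (matchedIffOdd-unique edge last-edge) level-x)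

  Balanced : Fin n → ℕ → Set
  Balanced u i = level (parity i) u ≡ fin i × level (parity i ⁻¹) u ≡ fin (T ∸ i)

  balanced : ∀ {u} (p q : Path) → PathTo Mt u p → PathTo Mt u q
           → len p + len q ≡ T → parity T ≡ 1ℙ → Balanced u (len p)
  balanced p q to-p to-q p+q≡T T-odd =
    level-p , subst₂ (λ σ k → level σ _ ≡ fin k) opposite q≡T∸p level-q
    where
    opposite : parity (len q) ≡ parity (len p) ⁻¹
    opposite = parity-+-odd (len p) (len q) (trans (cong parity p+q≡T) T-odd)
    shortest = opposite-paths-of-length-T-are-shortest p q to-p to-q opposite p+q≡T
    level-p = proj₂ (proj₁ shortest)
    level-q = proj₂ (proj₂ shortest)
    q≡T∸p : len q ≡ T ∸ len p
    q≡T∸p = trans (sym (m+n∸m≡n (len p) (len q))) (cong (_∸ len p) p+q≡T)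

  shortest-<⇒opposite-parity : ∀ {v} (P Q : Path) → Shortest v P → Shortest v Q
                            → len Q < len P → parity (len Q) ≡ parity (len P) ⁻¹
  shortest-<⇒opposite-parity P Q (_ , level-P) (_ , level-Q) Q<P
    with ≡∨≡⁻¹ (parity (len Q)) (parity (len P))
  ... | inj₂ opposite = opposite
  ... | inj₁ same = ⊥-elim (<⇒≢ Q<P (fin-injective
          (trans (sym level-Q) (trans (cong (λ σ → level σ _) same) level-P))))

  -- If Y meets the shortest path X at X_k = Y_r and leaves it for good, then Y_0 … Y_r X_{k+1} … X_end
  -- competes with X.
  rejoin : ∀ {v} (X Y : Path) → Shortest v X → PathTo Mt v Y → len X + len Y ≡ T
    → ∀ {k r} → k < len X → r < len Y → vtx Y r ≡ vtx X k
    → (∀ i j → i ≤ r → k < j → j < len X → vtx Y i ≢ vtx X j)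
    → parity r ≡ parity k × k ≤ r
  rejoin {v} X Y ((uX , endX) , level-X) (uY , endY) X+Y≡T {k} {r} k<X r<Y Y≡X disjoint =
    same-parity , k≤r
    where
    same-parity : parity r ≡ parity k
    same-parity with ≡∨≡⁻¹ (parity r) (parity k)
    ... | inj₁ same = same
    ... | inj₂ opposite = ⊥-elim (<⇒≱ k+r<T
          (T≤opposite-paths (prefix X k (<⇒≤ k<X)) (prefix Y r (<⇒≤ r<Y)) (uX , refl) (uY , Y≡X) opposite))
      where
      k+r<T : k + r < T
      k+r<T = <-≤-trans (+-mono-<-≤ k<X (<⇒≤ r<Y)) (≤-reflexive X+Y≡T)
    disjoint′ : ∀ i j → i ≤ r → k < j → j ≤ len X → vtx Y i ≢ vtx X j
    disjoint′ i j i≤r k<j j≤X with m≤n⇒m<n∨m≡n j≤X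
    ... | inj₁ j<X = disjoint i j i≤r k<j j<X
    ... | inj₂ refl = λ Y≡end → <⇒≢ (≤-<-trans i≤r r<Y)
          (simple Y i (len Y) (≤-trans i≤r (<⇒≤ r<Y)) ≤-refl (trans Y≡end (trans endX (sym endY))))
    ℓ = len X ∸ suc k
    X≡ : suc k + ℓ ≡ len X
    X≡ = m+[n∸m]≡n k<X
    detour : Path
    detour = toAltPath (joinForward (fromAltPath Y uY) r (<⇒≤ r<Y) (fromAltPath X uX) k k<X
                                    Y≡X same-parity disjoint′)
    detour-to-v : PathTo Mt v detour
    detour-to-v = uY , trans (splice-> r (vtx Y) (λ j → vtx X (j + suc k)) ℓ)
                        (trans (cong (vtx X) (m∸n+n≡m k<X)) endX)
    detour-parity : parity (len detour) ≡ parity (len X)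
    detour-parity = trans (parity-+-congʳ {suc r} {suc k} (parity-suc-cong {r} {k} same-parity) ℓ) (cong parity X≡)
    k≤r : k ≤ r
    k≤r = ≤-pred (+-cancelʳ-≤ ℓ (suc k) (suc r) (subst (_≤ suc r + ℓ) (sym X≡)
            (level≡⇒≤ detour detour-to-v
              (subst (λ σ → level σ v ≡ fin (len X)) (sym detour-parity) level-X))))

  record Junction (P Q : Path) : Set where
    field
      k       : ℕ
      k<Q     : k < len Q
      meet    : vtx P k ≡ vtx Q k
      after-P : ∀ i → k < i → i ≤ len P → Balanced (vtx P i) i
      after-Q : ∀ i → k < i → i ≤ len Q → Balanced (vtx Q i) i
      level-k : level (parity k) (vtx P k) ≡ fin k

  module JunctionProof {v} (P Q : Path) (shortest-P : Shortest v P) (shortest-Q : Shortest v Q)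
                       (P+Q≡T : len P + len Q ≡ T) (Q<P : len Q < len P) where

    L m : ℕ
    L = len P
    m = len Q
    uP = proj₁ (proj₁ shortest-P)
    uQ = proj₁ (proj₁ shortest-Q)
    P≡Q-at-end : vtx P L ≡ vtx Q m
    P≡Q-at-end = trans (proj₂ (proj₁ shortest-P)) (sym (proj₂ (proj₁ shortest-Q)))

    opposite : parity m ≡ parity L ⁻¹
    opposite = shortest-<⇒opposite-parity P Q shortest-P shortest-Q Q<P

    T-odd : parity T ≡ 1ℙ
    T-odd = begin
      parity T                   ≡⟨ cong parity (sym P+Q≡T) ⟩
      parity (L + m)             ≡⟨ +-homo-+ L m ⟩
      parity L ℙ.+ parity m      ≡⟨ cong (parity L ℙ.+_) opposite ⟩
      parity L ℙ.+ parity L ⁻¹   ≡⟨ ℙₚ.p+p⁻¹≡1ℙ (parity L) ⟩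
      1ℙ                         ∎
      where open ≡-Reasoning

    L′ : ℕ
    L′ = L ∸ 1
    1+L′≡L : suc L′ ≡ L
    1+L′≡L = m+[n∸m]≡n {1} (≤-trans (s≤s z≤n) Q<P)
    L′<L : L′ < L
    L′<L = ≤-reflexive 1+L′≡L
    parity-L′ : parity L′ ≡ parity m
    parity-L′ = sym (begin
      parity m               ≡⟨ opposite ⟩
      parity L ⁻¹            ≡⟨ cong (λ l → parity l ⁻¹) (sym 1+L′≡L) ⟩
      parity (suc L′) ⁻¹     ≡⟨ cong _⁻¹ (parity-suc L′) ⟩
      parity L′ ⁻¹ ⁻¹        ≡⟨ ℙₚ.⁻¹-involutive (parity L′) ⟩
      parity L′              ∎)
      where open ≡-Reasoning
    last-edge : vtx P (suc L′) ≡ vtx Q m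
    last-edge = trans (cong (vtx P) 1+L′≡L) P≡Q-at-end
    joint-adj : Adj (vtx P L′) (vtx Q m)
    joint-adj = subst (Adj (vtx P L′)) last-edge (adj P L′ L′<L)
    joint-alt : MatchedIffOdd (vtx P L′) (vtx Q m) (parity L′)
    joint-alt = subst (λ y → MatchedIffOdd (vtx P L′) y (parity L′)) last-edge (edge-matchedIffOdd P uP L′ L′<L)

    -- P₀ … P_{L′} Q_m Q_{m-1} … Q_c
    P-then-Q : ∀ c → c ≤ m → (∀ i j → i ≤ L′ → c ≤ j → j ≤ m → vtx P i ≢ vtx Q j) → Path
    P-then-Q c c≤m disjoint = toAltPath (joinReverse (fromAltPath P uP) L′ (<⇒≤ L′<L) (fromAltPath Q uQ)
      m c ≤-refl c≤m parity-L′ joint-adj joint-alt disjoint)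

    P-then-Q-to : ∀ c c≤m disjoint → PathTo Mt (vtx Q c) (P-then-Q c c≤m disjoint)
    P-then-Q-to c c≤m disjoint =
      uP , trans (splice-> L′ (vtx P) (λ j → vtx Q (m ∸ j)) (m ∸ c)) (cong (vtx Q) (m∸[m∸n]≡n c≤m))

    -- Q₀ … Q_m P_{L′} P_{L′-1} … P_c
    Q-then-P : ∀ c → c ≤ L′ → (∀ i j → i ≤ m → c ≤ j → j ≤ L′ → vtx Q i ≢ vtx P j) → Path
    Q-then-P c c≤L′ disjoint = toAltPath (joinReverse (fromAltPath Q uQ) m ≤-refl (fromAltPath P uP)
      L′ c (<⇒≤ L′<L) c≤L′ (sym parity-L′) (Adj-sym joint-adj)
      (matchedIffOdd-sym (subst (MatchedIffOdd (vtx P L′) (vtx Q m)) parity-L′ joint-alt)) disjoint)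

    Q-then-P-to : ∀ c c≤L′ disjoint → PathTo Mt (vtx P c) (Q-then-P c c≤L′ disjoint)
    Q-then-P-to c c≤L′ disjoint =
      uQ , trans (splice-> m (vtx Q) (λ j → vtx P (L′ ∸ j)) (L′ ∸ c)) (cong (vtx P) (m∸[m∸n]≡n c≤L′))

    OnQ : ℕ → Set
    OnQ s = ∃ λ r → r < suc m × vtx Q r ≡ vtx P s

    OnP : ℕ → Set
    OnP r = ∃ λ s → s < L × vtx P s ≡ vtx Q r

    -- Otherwise P₀ … P_{L′} Q_m … Q₀ would be augmenting of length L + m = T.
    P-meets-Q : ¬ (∀ s → s < L → ¬ OnQ s)
    P-meets-Q P∩Q≡∅ = <-irrefl (sym (trans (cong (_+ m) 1+L′≡L) P+Q≡T))
                               (T<augmenting detour (uP , u-end , ends-distinct))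
      where
      disjoint : ∀ i j → i ≤ L′ → 0 ≤ j → j ≤ m → vtx P i ≢ vtx Q j
      disjoint i j i≤L′ _ j≤m e = P∩Q≡∅ i (≤-<-trans i≤L′ L′<L) (j , s≤s j≤m , sym e)
      detour = P-then-Q 0 z≤n disjoint
      end≡ = proj₂ (P-then-Q-to 0 z≤n disjoint)
      u-end : Unmatched Mt (vtx detour (len detour))
      u-end = subst (Unmatched Mt) (sym end≡) uQ
      ends-distinct : vtx P 0 ≢ vtx detour (len detour)
      ends-distinct e = P∩Q≡∅ 0 (≤-<-trans z≤n L′<L) (0 , s≤s z≤n , sym (trans e end≡))

    OnQ? : Decidable OnQ
    OnQ? s = anyUpTo? (λ r → vtx Q r ≟ᶠ vtx P s) (suc m)

    OnP? : Decidable OnP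
    OnP? r = anyUpTo? (λ s → vtx P s ≟ᶠ vtx Q r) L

    meets-before-end : ∀ {r s} → r < suc m → s < L → vtx Q r ≡ vtx P s → r < m
    meets-before-end {r} {s} r<1+m s<L Q≡P with m≤n⇒m<n∨m≡n (≤-pred r<1+m)
    ... | inj₁ r<m = r<m
    ... | inj₂ refl = ⊥-elim (<⇒≢ s<L (simple P s L (<⇒≤ s<L) ≤-refl (trans (sym Q≡P) (sym P≡Q-at-end))))

    balanced-at-v : Balanced v L × Balanced v m
    balanced-at-v = balanced P Q (proj₁ shortest-P) (proj₁ shortest-Q) P+Q≡T T-odd ,
                    balanced Q P (proj₁ shortest-Q) (proj₁ shortest-P) (trans (+-comm m L) P+Q≡T) T-odd

    balanced-after-P : ∀ {k} → (∀ j → k < j → j < L → ¬ OnQ j)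
                     → ∀ i → k < i → i ≤ L → Balanced (vtx P i) i
    balanced-after-P {k} P-leaves i k<i i≤L with m≤n⇒m<n∨m≡n i≤L
    ... | inj₂ refl = subst (λ u → Balanced u L) (sym (proj₂ (proj₁ shortest-P))) (proj₁ balanced-at-v)
    ... | inj₁ i<L = balanced (prefix P i i≤L) (Q-then-P i i≤L′ disjoint)
                       (uP , refl) (Q-then-P-to i i≤L′ disjoint) i+[T∸i]≡T T-odd
      where
      i≤L′ : i ≤ L′
      i≤L′ = ≤-pred (subst (suc i ≤_) (sym 1+L′≡L) i<L)
      disjoint : ∀ i′ j → i′ ≤ m → i ≤ j → j ≤ L′ → vtx Q i′ ≢ vtx P j
      disjoint i′ j i′≤m i≤j j≤L′ e =
        P-leaves j (<-≤-trans k<i i≤j) (≤-<-trans j≤L′ L′<L) (i′ , s≤s i′≤m , e)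
      i+[T∸i]≡T : i + (suc m + (L′ ∸ i)) ≡ T
      i+[T∸i]≡T = trans (+-∸-rotate (suc m) i≤L′)
                    (trans (+-suc L′ m) (trans (cong (_+ m) 1+L′≡L) P+Q≡T))

    balanced-after-Q : ∀ {k} → (∀ j → k < j → j < suc m → ¬ OnP j)
                     → ∀ i → k < i → i ≤ m → Balanced (vtx Q i) i
    balanced-after-Q {k} Q-leaves i k<i i≤m with m≤n⇒m<n∨m≡n i≤m
    ... | inj₂ refl = subst (λ u → Balanced u m) (sym (proj₂ (proj₁ shortest-Q))) (proj₂ balanced-at-v)
    ... | inj₁ i<m = balanced (prefix Q i i≤m) (P-then-Q i i≤m disjoint)
                       (uQ , refl) (P-then-Q-to i i≤m disjoint) i+[T∸i]≡T T-odd
      where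
      disjoint : ∀ i′ j → i′ ≤ L′ → i ≤ j → j ≤ m → vtx P i′ ≢ vtx Q j
      disjoint i′ j i′≤L′ i≤j j≤m e =
        Q-leaves j (<-≤-trans k<i i≤j) (s≤s j≤m) (i′ , ≤-<-trans i′≤L′ L′<L , e)
      i+[T∸i]≡T : i + (suc L′ + (m ∸ i)) ≡ T
      i+[T∸i]≡T = trans (+-∸-rotate (suc L′) i≤m)
                    (trans (+-comm m (suc L′)) (trans (cong (_+ m) 1+L′≡L) P+Q≡T))

    -- A shorter path to P_k, extended along P, would undercut the levels of P_{k+1}.
    level-at-junction : ∀ {k} → k < m → (∀ i → k < i → i ≤ L → Balanced (vtx P i) i)
                      → level (parity k) (vtx P k) ≡ fin k
    level-at-junction {k} k<m after = trans level-a (cong fin (≤-antisym a≤k k≤a))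
      where
      k<L : k < L
      k<L = <-trans k<m Q<P
      prefix-bound = level-≤ (prefix P k (<⇒≤ k<L)) (uP , refl)
      a : ℕ
      a = proj₁ prefix-bound
      level-a : level (parity k) (vtx P k) ≡ fin a
      level-a = proj₁ (proj₂ prefix-bound)
      a≤k : a ≤ k
      a≤k = proj₂ (proj₂ prefix-bound)
      next : Balanced (vtx P (suc k)) (suc k)
      next = after (suc k) (n<1+n k) k<L
      level-next : ∀ {σ c} → parity (suc k) ≡ σ → level σ (vtx P (suc k)) ≡ fin c → c ≡ suc k
      level-next e level-c = fin-injective (trans (sym level-c) (subst (λ σ → level σ _ ≡ _) e (proj₁ next)))
      k≤a : k ≤ a
      k≤a with extend-or-revisit (adj P k k<L) (edge-matchedIffOdd P uP k k<L) level-a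
      ... | inj₁ (R , to-next , len≡ , _) = ≤-pred (subst (suc k ≤_) len≡ (level≡⇒≤ R to-next
              (subst (λ σ → level σ (vtx P (suc k)) ≡ fin (suc k))
                     (sym (trans (cong parity len≡)
                                 (parity-suc-cong {a} {k} (level-parity (parity k) (vtx P k) level-a))))
                     (proj₁ next))))
      ... | inj₂ (r , r≤a , c , level-r , c≤r) = ⊥-elim (revisit (≡∨≡⁻¹ (parity r) (parity (suc k))))
        where
        c≤k : c ≤ k
        c≤k = ≤-trans c≤r (≤-trans r≤a a≤k)
        revisit : parity r ≡ parity (suc k) ⊎ parity r ≡ parity (suc k) ⁻¹ → ⊥
        revisit (inj₁ same) = <⇒≱ (s≤s c≤k) (≤-reflexive
          (sym (level-next refl (subst (λ σ → level σ _ ≡ fin c) same level-r))))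
        revisit (inj₂ opposite) = <⇒≱ k<T∸[1+k] (subst (_≤ k) c≡ c≤k)
          where
          c≡ : c ≡ T ∸ suc k
          c≡ = fin-injective (trans (sym (subst (λ σ → level σ _ ≡ fin c) opposite level-r)) (proj₂ next))
          k<T∸[1+k] : k < T ∸ suc k
          k<T∸[1+k] = m+n≤o⇒m≤o∸n (suc k) (subst (suc k + suc k ≤_) (trans (+-comm m L) P+Q≡T)
                                                    (+-mono-≤ k<m k<L))

    -- k is the last position of P on Q (there P_k = Q_r) and r′ the last position of Q on P
    -- (there Q_r′ = P_s′); rejoin and maximality give r ≤ r′ ≤ s′ ≤ k ≤ r.
    junction : Junction P Q
    junction with largest OnQ? L
    ... | inj₁ P∩Q≡∅ = ⊥-elim (P-meets-Q P∩Q≡∅)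
    ... | inj₂ (k , k<L , (r , r<1+m , Q[r]≡P[k]) , P-leaves) with largest OnP? (suc m)
    ...   | inj₁ Q∩P≡∅ = ⊥-elim (Q∩P≡∅ r r<1+m (k , k<L , sym Q[r]≡P[k]))
    ...   | inj₂ (r′ , r′<1+m , (s′ , s′<L , P[s′]≡Q[r′]) , Q-leaves) = record
      { k = k ; k<Q = subst (_< m) r≡k r<m ; meet = trans (sym Q[r]≡P[k]) (cong (vtx Q) r≡k)
      ; after-P = after-P
      ; after-Q = balanced-after-Q (subst (λ j → ∀ i → j < i → i < suc m → ¬ OnP i) r′≡k Q-leaves)
      ; level-k = level-at-junction (subst (_< m) r≡k r<m) after-P }
      where
      after-P = balanced-after-P P-leaves
      r<m : r < m
      r<m = meets-before-end r<1+m k<L Q[r]≡P[k]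
      r′<m : r′ < m
      r′<m = meets-before-end r′<1+m s′<L (sym P[s′]≡Q[r′])
      k≤r : k ≤ r
      k≤r = proj₂ (rejoin P Q shortest-P (proj₁ shortest-Q) P+Q≡T k<L r<m Q[r]≡P[k]
              (λ i j i≤r k<j j<L e → P-leaves j k<j j<L (i , s≤s (≤-trans i≤r (<⇒≤ r<m)) , e)))
      r′≤s′ : r′ ≤ s′
      r′≤s′ = proj₂ (rejoin Q P shortest-Q (proj₁ shortest-P) (trans (+-comm m L) P+Q≡T)
                r′<m s′<L P[s′]≡Q[r′]
                (λ i j i≤s′ r′<j j<m e → Q-leaves j r′<j (m<n⇒m<1+n j<m) (i , ≤-<-trans i≤s′ s′<L , e)))
      r≤r′ : r ≤ r′
      r≤r′ = ≮⇒≥ λ r′<r → Q-leaves r r′<r r<1+m (k , k<L , sym Q[r]≡P[k])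
      s′≤k : s′ ≤ k
      s′≤k = ≮⇒≥ λ k<s′ → P-leaves s′ k<s′ s′<L (r′ , r′<1+m , sym P[s′]≡Q[r′])
      r≡k : r ≡ k
      r≡k = ≤-antisym (≤-trans r≤r′ (≤-trans r′≤s′ s′≤k)) k≤r
      r′≡k : r′ ≡ k
      r′≡k = ≤-antisym (≤-trans r′≤s′ s′≤k) (≤-trans k≤r r≤r′)

  junction : ∀ {v} (P Q : Path) → Shortest v P → Shortest v Q
           → len P + len Q ≡ T → len Q < len P → Junction P Q
  junction P Q shortest-P shortest-Q P+Q≡T Q<P = JunctionProof.junction P Q shortest-P shortest-Q P+Q≡T Q<P

  edge-tenacity : ∀ {x y π a b} → MatchedIffOdd x y π → level π x ≡ fin a → level π y ≡ fin b
                → EdgeTenacity x y (fin (suc (a + b)))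
  edge-tenacity {x} {y} {0ℙ} {a} {b} edge e₁ e₂ =
    (λ m → ⊥-elim (p≢p⁻¹ 0ℙ (Equivalence.to edge m))) ,
    (λ _ → trans (cong₂ (λ p q → p +∞ q +∞ fin 1) e₁ e₂) (cong fin (+-comm (a + b) 1)))
  edge-tenacity {x} {y} {1ℙ} {a} {b} edge e₁ e₂ =
    (λ _ → trans (cong₂ (λ p q → p +∞ q +∞ fin 1) e₁ e₂) (cong fin (+-comm (a + b) 1))) ,
    (λ ¬m → ⊥-elim (¬m (Equivalence.from edge refl)))

  edge-tenacity⁻¹ : ∀ {x y π} → MatchedIffOdd x y π → EdgeTenacity x y (fin T)
                  → ∃ λ a → ∃ λ b → level π x ≡ fin a × level π y ≡ fin b × suc (a + b) ≡ T
  edge-tenacity⁻¹ {x} {y} {0ℙ} edge (_ , unmatched) =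
    +∞-fin⁻¹ (el x) (el y) (unmatched (λ m → p≢p⁻¹ 0ℙ (Equivalence.to edge m)))
  edge-tenacity⁻¹ {x} {y} {1ℙ} edge (matched , _) = +∞-fin⁻¹ (ol x) (ol y) (matched (Equivalence.from edge refl))

  record Orientation (v : Fin n) : Set where
    field
      π       : Parity
      L m     : ℕ
      level-L : level π v ≡ fin L
      level-m : level (π ⁻¹) v ≡ fin m
      L+m≡T   : L + m ≡ T
      m<L     : m < L

  orientation : ∀ v → tenacity v ≡ fin T → Orientation v
  orientation v ten≡T with el v in el≡ | ol v in ol≡
  ... | fin e | fin o with <-cmp e o
  ...   | tri< e<o _ _ = record { π = 1ℙ ; L = o ; m = e ; level-L = ol≡ ; level-m = el≡
                                ; L+m≡T = trans (+-comm o e) (fin-injective ten≡T) ; m<L = e<o }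
  ...   | tri> _ _ o<e = record { π = 0ℙ ; L = e ; m = o ; level-L = el≡ ; level-m = ol≡
                                ; L+m≡T = fin-injective ten≡T ; m<L = o<e }
  ...   | tri≈ _ refl _ = ⊥-elim (p≢p⁻¹ 0ℙ (trans (sym (level-parity 0ℙ v el≡)) (level-parity 1ℙ v ol≡)))
  orientation v () | fin e | ∞
  orientation v () | ∞ | _

  module _ (P : Path) (uP : Unmatched Mt (vtx P 0)) {k h : ℕ} (1+2h≡T : suc (h + h) ≡ T) (k<h : k < h)
           (after : ∀ i → k < i → i ≤ len P → Balanced (vtx P i) i) where

    middle-edge-bridge : h < len P → Bridge (vtx P h) (vtx P (suc h)) × EdgeTenacity (vtx P h) (vtx P (suc h)) (fin T)
    middle-edge-bridge h<P =
      (adj P h h<P , not-prop) ,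
      subst (λ t → EdgeTenacity (vtx P h) (vtx P (suc h)) (fin t)) 1+2h≡T (edge-tenacity edge level-h level-h+1)
      where
      edge : MatchedIffOdd (vtx P h) (vtx P (suc h)) (parity h)
      edge = edge-matchedIffOdd P uP h h<P
      level-h : level (parity h) (vtx P h) ≡ fin h
      level-h = proj₁ (after h k<h (<⇒≤ h<P))
      level-h+1 : level (parity h) (vtx P (suc h)) ≡ fin h
      level-h+1 = subst₂ (λ σ c → level σ (vtx P (suc h)) ≡ fin c)
                    (trans (cong _⁻¹ (parity-suc h)) (ℙₚ.⁻¹-involutive (parity h)))
                    (trans (cong (_∸ suc h) (sym 1+2h≡T)) (m+n∸m≡n (suc h) h))
                    (proj₂ (after (suc h) (m<n⇒m<1+n k<h) h<P))
      not-prop : ¬ PropEdge (vtx P h) (vtx P (suc h))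
      not-prop (inj₁ prop) = equal-levels⇒¬prop edge level-h level-h+1 prop
      not-prop (inj₂ prop) = equal-levels⇒¬prop (matchedIffOdd-sym edge) level-h+1 level-h prop

    -- A bridge of tenacity T has equal end levels, so both are h; past the junction the level is the position.
    bridge-at-middle : ∀ j → j < len P → Bridge (vtx P j) (vtx P (suc j))
                     → EdgeTenacity (vtx P j) (vtx P (suc j)) (fin T) → j ≡ h
    bridge-at-middle j j<P (P[j]~P[j+1] , ¬prop) tenacity-T
      with edge-tenacity⁻¹ (edge-matchedIffOdd P uP j j<P) tenacity-T
    ... | a , b , level-a , level-b , 1+a+b≡T with <-cmp a b
    ...   | tri< a<b _ _ = ⊥-elim (¬prop (inj₁
              (lower-end-edge⇒prop P[j]~P[j+1] (edge-matchedIffOdd P uP j j<P) level-a level-b 1+a+b≡T a<b)))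
    ...   | tri> _ _ b<a = ⊥-elim (¬prop (inj₂
              (lower-end-edge⇒prop (Adj-sym P[j]~P[j+1]) (matchedIffOdd-sym (edge-matchedIffOdd P uP j j<P))
                 level-b level-a (trans (cong suc (+-comm b a)) 1+a+b≡T) b<a)))
    ...   | tri≈ _ refl _ = compare (<-cmp j h)
      where
      a≡h : a ≡ h
      a≡h = double-injective (suc-injective (trans 1+a+b≡T (sym 1+2h≡T)))
      compare : Tri (j < h) (j ≡ h) (h < j) → j ≡ h
      compare (tri≈ _ j≡h _) = j≡h
      compare (tri< j<h _ _) = ⊥-elim (<⇒≱ j<h (subst (_≤ j) a≡h
        (level≡⇒≤ (prefix P j (<⇒≤ j<P)) (uP , refl) level-a)))
      compare (tri> _ _ h<j) = ⊥-elim (<⇒≢ h<j (trans (sym a≡h)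
        (fin-injective (trans (sym level-a) (proj₁ (after j (<-trans k<h h<j) (<⇒≤ j<P)))))))

  unique-bridge : ∀ {v} (P Q : Path) → Shortest v P → Shortest v Q → len P + len Q ≡ T → len Q < len P
    → Σ ℕ λ i → i < len P
        × Bridge (vtx P i) (vtx P (suc i))
        × EdgeTenacity (vtx P i) (vtx P (suc i)) (fin T)
        × (∀ j → j < len P → Bridge (vtx P j) (vtx P (suc j))
             → EdgeTenacity (vtx P j) (vtx P (suc j)) (fin T) → j ≡ i)
  unique-bridge P Q shortest-P shortest-Q P+Q≡T Q<P =
    h , h<P , proj₁ middle , proj₂ middle , bridge-at-middle P uP 1+2h≡T k<h after-P
    where
    open Junction (junction P Q shortest-P shortest-Q P+Q≡T Q<P)
    uP = proj₁ (proj₁ shortest-P)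
    half = odd⇒1+2h T (JunctionProof.T-odd P Q shortest-P shortest-Q P+Q≡T Q<P)
    h = proj₁ half
    1+2h≡T : suc (h + h) ≡ T
    1+2h≡T = proj₂ half
    Q≤h : len Q ≤ h
    Q≤h = ≮⇒≥ λ h<Q → <⇒≱ (+-mono-< h<Q h<Q)
            (≤-pred (subst (suc (len Q + len Q) ≤_) (trans P+Q≡T (sym 1+2h≡T)) (+-monoˡ-≤ (len Q) Q<P)))
    h<P : h < len P
    h<P = +-cancelʳ-≤ h (suc h) (len P)
            (subst (_≤ len P + h) (sym 1+2h≡T) (subst (_≤ len P + h) P+Q≡T (+-monoʳ-≤ (len P) Q≤h)))
    k<h : k < h
    k<h = <-≤-trans k<Q Q≤h
    middle = middle-edge-bridge P uP 1+2h≡T k<h after-P h<P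

  balanced⇒tenacity≡T : ∀ {u i} → Balanced u i → i ≤ T → tenacity u ≡ fin T
  balanced⇒tenacity≡T {i = i} (level-i , level-T∸i) i≤T =
    trans (tenacity≡ (parity i) _ level-i level-T∸i) (cong fin (m+[n∸m]≡n i≤T))

  T<oddlevel-of-unmatched : ∀ {x c} → Unmatched Mt x → ol x ≡ fin c → T < c
  T<oddlevel-of-unmatched {x} u ol≡c with level-path 1ℙ x ol≡c
  ... | Z , (uZ , end) , refl , odd =
    T<augmenting Z (uZ , subst (Unmatched Mt) (sym end) u , λ e → p≢p⁻¹ 0ℙ
      (trans (cong parity (simple Z 0 (len Z) z≤n ≤-refl e)) odd))

  T<tenacity-of-unmatched : ∀ x → Unmatched Mt x → fin T <∞ tenacity x
  T<tenacity-of-unmatched x u with ol x in ol≡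
  ... | ∞ = subst (fin T <∞_) (sym (+∞-∞ (el x))) (fin<∞∞ T)
    where +∞-∞ : ∀ z → z +∞ ∞ ≡ ∞
          +∞-∞ (fin _) = refl
          +∞-∞ ∞ = refl
  ... | fin c with el x
  ...   | ∞ = fin<∞∞ T
  ...   | fin e = fin<∞fin (<-≤-trans (T<oddlevel-of-unmatched u ol≡) (m≤n+m c e))

  F-exists : ∀ {x} (X : Path) → PathTo Mt x X → ∃ λ w → IsF (fin T) X w
  F-exists X (u , _) with largest (λ i → fin<∞? T (tenacity (vtx X i))) (suc (len X))
  ... | inj₁ none = ⊥-elim (none 0 (s≤s z≤n) (T<tenacity-of-unmatched (vtx X 0) u))
  ... | inj₂ (i , i<1+X , T<ten , above) =
    vtx X i , i , ≤-pred i<1+X , refl , T<ten , λ j i<j j≤X → above j i<j (s≤s j≤X)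

  F-index-≤ : ∀ (X : Path) {k w} → (F : IsF (fin T) X w) → len X ≤ T
            → (∀ i → k < i → i ≤ len X → Balanced (vtx X i) i) → proj₁ F ≤ k
  F-index-≤ X (i , i≤X , X[i]≡w , T<ten , _) X≤T after = ≮⇒≥ λ k<i →
    proj₂ T<ten (sym (subst (λ u → tenacity u ≡ fin T) X[i]≡w
                        (balanced⇒tenacity≡T (after i k<i i≤X) (≤-trans i≤X X≤T))))

  UniqueF : Fin n → Set
  UniqueF v = ∀ X Y → Shortest v X → Shortest v Y → ∀ {x y} → IsF (fin T) X x → IsF (fin T) Y y → x ≡ y

  -- Beyond the junction w every vertex has tenacity T, so both F's lie at or before w; either w itself
  -- has tenacity > T, or the two prefixes up to w are shortest paths to w, of smaller minlevel.
  F-agree : ∀ {v} (P Q : Path) → Shortest v P → Shortest v Q → len P + len Q ≡ T → len Q < len P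
    → (∀ {w μ} → tenacity w ≡ fin T → minlevel w ≡ fin μ → μ < len Q → UniqueF w)
    → ∀ {x y} → IsF (fin T) P x → IsF (fin T) Q y → x ≡ y
  F-agree P Q shortest-P shortest-Q P+Q≡T Q<P IH {x} {y} F-P F-Q = at-junction (fin<∞? T (tenacity w))
    where
    open Junction (junction P Q shortest-P shortest-Q P+Q≡T Q<P)
    w = vtx P k
    i = proj₁ F-P
    j = proj₁ F-Q
    k≤Q : k ≤ len Q
    k≤Q = <⇒≤ k<Q
    k≤P : k ≤ len P
    k≤P = <⇒≤ (<-trans k<Q Q<P)
    i≤k : i ≤ k
    i≤k = F-index-≤ P F-P (subst (len P ≤_) P+Q≡T (m≤m+n (len P) (len Q))) after-P
    j≤k : j ≤ k
    j≤k = F-index-≤ Q F-Q (subst (len Q ≤_) P+Q≡T (m≤n+m (len Q) (len P))) after-Q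
    P-beyond = proj₂ (proj₂ (proj₂ (proj₂ F-P)))
    Q-beyond = proj₂ (proj₂ (proj₂ (proj₂ F-Q)))
    at-junction : Dec (fin T <∞ tenacity w) → x ≡ y
    at-junction (yes T<w) = begin
      x          ≡⟨ sym (proj₁ (proj₂ (proj₂ F-P))) ⟩
      vtx P i    ≡⟨ cong (vtx P) (≤-antisym i≤k (≮⇒≥ λ i<k → P-beyond k i<k k≤P T<w)) ⟩
      vtx P k    ≡⟨ meet ⟩
      vtx Q k    ≡⟨ cong (vtx Q) (≤-antisym (≮⇒≥ λ j<k → Q-beyond k j<k k≤Q T<Q[k]) j≤k) ⟩
      vtx Q j    ≡⟨ proj₁ (proj₂ (proj₂ F-Q)) ⟩
      y          ∎
      where
      open ≡-Reasoning
      T<Q[k] : fin T <∞ tenacity (vtx Q k)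
      T<Q[k] = subst (λ u → fin T <∞ tenacity u) meet T<w
    at-junction (no T≮w) =
      IH (≤∞∧≮∞⇒≡ (T≤tenacity w) T≮w) (proj₁ (proj₂ minlevel-w))
         (≤-<-trans (proj₂ (proj₂ minlevel-w)) k<Q)
         (prefix P k k≤P) (prefix Q k k≤Q)
         ((proj₁ (proj₁ shortest-P) , refl) , level-k)
         ((proj₁ (proj₁ shortest-Q) , sym meet) , level-k)
         (i , i≤k , proj₁ (proj₂ (proj₂ F-P)) , proj₁ (proj₂ (proj₂ (proj₂ F-P))) ,
          λ j′ i<j′ j′≤k → P-beyond j′ i<j′ (≤-trans j′≤k k≤P))
         (j , j≤k , proj₁ (proj₂ (proj₂ F-Q)) , proj₁ (proj₂ (proj₂ (proj₂ F-Q))) ,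
          λ j′ j<j′ j′≤k → Q-beyond j′ j<j′ (≤-trans j′≤k k≤Q))
      where
      minlevel-w = ∃minlevel≤level (parity k) w level-k

  shortest-length : ∀ {v π a} (Z : Path) → Shortest v Z → parity (len Z) ≡ π → level π v ≡ fin a → len Z ≡ a
  shortest-length Z (_ , level-Z) parity≡π level-a =
    fin-injective (trans (sym (subst (λ σ → level σ _ ≡ fin (len Z)) parity≡π level-Z)) level-a)

  unique-F : ∀ μ {v} → tenacity v ≡ fin T → minlevel v ≡ fin μ → UniqueF v
  unique-F = <-rec (λ μ → ∀ {v} → tenacity v ≡ fin T → minlevel v ≡ fin μ → UniqueF v) step
    where
    step : ∀ μ → (∀ {μ′} → μ′ < μ → ∀ {v} → tenacity v ≡ fin T → minlevel v ≡ fin μ′ → UniqueF v)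
         → ∀ {v} → tenacity v ≡ fin T → minlevel v ≡ fin μ → UniqueF v
    step μ IH {v} tenacity-v minlevel-v X Y shortest-X shortest-Y F-X F-Y =
      trans (to-F-Q₀ X shortest-X F-X) (sym (to-F-Q₀ Y shortest-Y F-Y))
      where
      open Orientation (orientation v tenacity-v)
      m≡μ : m ≡ μ
      m≡μ = fin-injective (trans (sym (minlevel≡ (π ⁻¹) v level-m
              (subst (λ σ → level σ v ≡ fin L) (sym (ℙₚ.⁻¹-involutive π)) level-L) (<⇒≤ m<L))) minlevel-v)
      P₀-data = level-shortest π v level-L
      Q₀-data = level-shortest (π ⁻¹) v level-m
      P₀ = proj₁ P₀-data
      Q₀ = proj₁ Q₀-data
      shortest-P₀ = proj₁ (proj₂ P₀-data)
      shortest-Q₀ = proj₁ (proj₂ Q₀-data)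
      F-P₀ = F-exists P₀ (proj₁ shortest-P₀)
      F-Q₀ = F-exists Q₀ (proj₁ shortest-Q₀)
      agree : ∀ (Z W : Path) → Shortest v Z → Shortest v W → len Z ≡ L → len W ≡ m
            → ∀ {z w} → IsF (fin T) Z z → IsF (fin T) W w → z ≡ w
      agree Z W shortest-Z shortest-W Z≡L W≡m =
        F-agree Z W shortest-Z shortest-W (subst₂ (λ a b → a + b ≡ T) (sym Z≡L) (sym W≡m) L+m≡T)
          (subst₂ _<_ (sym W≡m) (sym Z≡L) m<L)
          (λ tenacity-w minlevel-w μ′<W →
             IH (≤-trans μ′<W (≤-reflexive (trans W≡m m≡μ))) tenacity-w minlevel-w)
      P₀≡L = proj₁ (proj₂ (proj₂ P₀-data))
      Q₀≡m = proj₁ (proj₂ (proj₂ Q₀-data))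
      to-F-Q₀ : ∀ Z → Shortest v Z → ∀ {z} → IsF (fin T) Z z → z ≡ proj₁ F-Q₀
      to-F-Q₀ Z shortest-Z F-Z with ≡∨≡⁻¹ (parity (len Z)) π
      ... | inj₁ long = agree Z Q₀ shortest-Z shortest-Q₀ (shortest-length Z shortest-Z long level-L) Q₀≡m
                          F-Z (proj₂ F-Q₀)
      ... | inj₂ short = trans
        (sym (agree P₀ Z shortest-P₀ shortest-Z P₀≡L (shortest-length Z shortest-Z short level-m)
                    (proj₂ F-P₀) F-Z))
        (agree P₀ Q₀ shortest-P₀ shortest-Q₀ P₀≡L Q₀≡m (proj₂ F-P₀) (proj₂ F-Q₀))

  B-singleton : ∀ {v} → tenacity v ≡ fin T
              → ∃ λ w → ∀ u → (InB (fin T) v u → u ≡ w) × (u ≡ w → InB (fin T) v u)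
  B-singleton {v} tenacity-v =
    proj₁ F-P₀ ,
    λ u → (λ { (p , level-p , F-p) → unique-F m tenacity-v minlevel-v p P₀ (levelPath⇒shortest p level-p)
                                               shortest-P₀ F-p (proj₂ F-P₀) }) ,
          (λ { refl → P₀ , shortest⇒levelPath P₀ shortest-P₀ , proj₂ F-P₀ })
    where
    open Orientation (orientation v tenacity-v)
    P₀-data = level-shortest π v level-L
    P₀ = proj₁ P₀-data
    shortest-P₀ = proj₁ (proj₂ P₀-data)
    F-P₀ = F-exists P₀ (proj₁ shortest-P₀)
    minlevel-v : minlevel v ≡ fin m
    minlevel-v = minlevel≡ (π ⁻¹) v level-m
                   (subst (λ σ → level σ v ≡ fin L) (sym (ℙₚ.⁻¹-involutive π)) level-L) (<⇒≤ m<L)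

  maxlevel-path-bridge : ∀ {v} → tenacity v ≡ fin T → ∀ p → MaxlevelPath v p
    → Σ ℕ λ i → i < len p
        × Bridge (vtx p i) (vtx p (suc i))
        × EdgeTenacity (vtx p i) (vtx p (suc i)) (fin T)
        × (∀ j → j < len p → Bridge (vtx p j) (vtx p (suc j))
             → EdgeTenacity (vtx p j) (vtx p (suc j)) (fin T) → j ≡ i)
  maxlevel-path-bridge {v} tenacity-v p (level-p , maxlevel-p) =
    unique-bridge p Q₀ (levelPath⇒shortest p level-p) shortest-Q₀
      (subst₂ (λ a b → a + b ≡ T) (sym p≡L) (sym Q₀≡m) L+m≡T) (subst₂ _<_ (sym Q₀≡m) (sym p≡L) m<L)
    where
    open Orientation (orientation v tenacity-v)
    Q₀-data = level-shortest (π ⁻¹) v level-m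
    Q₀ = proj₁ Q₀-data
    shortest-Q₀ = proj₁ (proj₂ Q₀-data)
    Q₀≡m = proj₁ (proj₂ (proj₂ Q₀-data))
    p≡L : len p ≡ L
    p≡L = fin-injective (trans maxlevel-p (maxlevel≡ π v level-L level-m (<⇒≤ m<L)))

below-min-augmenting : ∀ {n} {G : Graph n} (Mt : Matching G) {T lm} → fin T <∞ lm → IsMinAugLength Mt lm
                     → ∀ p → Augmenting Mt p → T < len p
below-min-augmenting Mt {T} {fin l} (fin≤fin T≤l , T≢l) (lm≤ , _) p augmenting with lm≤ p augmenting
... | fin≤fin l≤p = <-≤-trans (≤∧≢⇒< T≤l λ e → T≢l (cong fin e)) l≤p
below-min-augmenting Mt {lm = ∞} _ (lm≤ , _) p augmenting with lm≤ p augmenting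
... | ()

lemma6p4 : {n : ℕ} (G : Graph n) (Mt : Matching G)
    (el ol : Fin n → ℕ∞)
    → (∀ v → IsEvenLevel Mt v (el v))
    → (∀ v → IsOddLevel Mt v (ol v))
    → (tm lm : ℕ∞)
    → Levels.IsMinTenacity Mt el ol tm
    → IsMinAugLength Mt lm
    → tm <∞ lm
    → (v : Fin n) → Levels.tenacity Mt el ol v ≡ tm
    → (∃ λ w → ∀ u → (Levels.InB Mt el ol tm v u → u ≡ w)
                     × (u ≡ w → Levels.InB Mt el ol tm v u))
      × (∀ p → Levels.MaxlevelPath Mt el ol v p
           → Σ ℕ λ i → i < len p
               × Levels.Bridge Mt el ol (vtx p i) (vtx p (suc i))
               × Levels.EdgeTenacity Mt el ol (vtx p i) (vtx p (suc i)) tm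
               × (∀ j → j < len p
                    → Levels.Bridge Mt el ol (vtx p j) (vtx p (suc j))
                    → Levels.EdgeTenacity Mt el ol (vtx p j) (vtx p (suc j)) tm
                    → j ≡ i))
lemma6p4 G Mt el ol evenlevel oddlevel ∞ lm _ _ ((_ ≤∞∞) , ∞≢lm) v _ = ⊥-elim (∞≢lm refl)
lemma6p4 G Mt el ol evenlevel oddlevel (fin T) lm (_ , T≤tenacity) min-augmenting T<lm v tenacity-v =
  B-singleton tenacity-v , maxlevel-path-bridge tenacity-v
  where
  open Tenacity Mt el ol evenlevel oddlevel T T≤tenacity (below-min-augmenting Mt T<lm min-augmenting)
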